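{- Let $n\ge1$ and let $I=\{i_1,i_2,\ldots,i_k\}\subseteq[n]$ with $1=i_1<i_2<\cdots<i_k\le n$ be such that there exists a weakly increasing Fubini ranking with $n$ competitors whose set of lucky cars is $I$. Then there exists a unique weakly increasing Fubini ranking $\alpha$ with $n$ competitors such that $\mathrm{Lucky}(\alpha)=I$.
   Context: A Fubini ranking with $n$ competitors is a tuple $\alpha=(a_1,\ldots,a_n)\in[n]^n$ with $a_i=1+|\{j:a_j<a_i\}|$ for every $i$; it is weakly increasing if $a_1\le\cdots\le a_n$. Lucky cars: cars $1,\ldots,n$ enter in order a one-way street with spots $1,\ldots,n$; car $i$ parks at spot $a_i$ if free, else at the first free spot after $a_i$; car $i$ is lucky if it parks at spot $a_i$. $\mathrm{Lucky}(\alpha)$ denotes the set of lucky cars. -}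

module Defs where

open import Data.Nat using (ℕ; zero; suc; _≤_; _<?_; _≟_)
open import Data.Bool using (Bool; if_then_else_)
open import Data.Fin using (Fin)
import Data.Fin as F
open import Data.Vec using (Vec; []; _∷_; lookup; toList; tabulate)
open import Data.List using (List; length; filter; _∷_)
open import Data.List.Membership.DecPropositional _≟_ using (_∈?_)
open import Data.Fin.Subset using (Subset)
open import Data.Product using (_×_)
open import Relation.Binary.PropositionalEquality using (_≡_)
open import Relation.Nullary.Decidable using (⌊_⌋)

-- A preference / ranking tuple with n competitors: α = (a_1,…,a_n), stored as
-- a vector; car i (1-based in the paper) is index i-1 : Fin n here.
-- Values are the paper's (1-based) ranks/spots.

InRange : ∀ {n} → Vec ℕ n → Set
InRange {n} α = ∀ i → 1 ≤ lookup α i × lookup α i ≤ n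

countBelow : ∀ {n} → Vec ℕ n → ℕ → ℕ
countBelow α x = length (filter (λ y → y <? x) (toList α))

IsFubini : ∀ {n} → Vec ℕ n → Set
IsFubini α = InRange α × (∀ i → lookup α i ≡ suc (countBelow α (lookup α i)))

WeaklyIncreasing : ∀ {n} → Vec ℕ n → Set
WeaklyIncreasing α = ∀ i j → i F.≤ j → lookup α i ≤ lookup α j

-- First free spot ≥ s given occupied spots occ (checks at most 'fuel' spots;
-- fuel ≥ |occ| suffices by pigeonhole).
firstFree : ℕ → List ℕ → ℕ → ℕ
firstFree zero occ s = s
firstFree (suc f) occ s = if ⌊ s ∈? occ ⌋ then firstFree f occ (suc s) else s

parkAux : ∀ {m} → List ℕ → Vec ℕ m → Vec ℕ m
parkAux occ [] = []
parkAux occ (a ∷ as) =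
  let s = firstFree (suc (length occ)) occ a in s ∷ parkAux (s ∷ occ) as

parkingOutcome : ∀ {n} → Vec ℕ n → Vec ℕ n
parkingOutcome α = parkAux Data.List.[] α

Lucky : ∀ {n} → Vec ℕ n → Subset n
Lucky α = tabulate (λ i → ⌊ lookup (parkingOutcome α) i ≟ lookup α i ⌋)

WIFRWithLucky : ∀ {n} → Subset n → Vec ℕ n → Set
WIFRWithLucky I α = IsFubini α × WeaklyIncreasing α × Lucky α ≡ I

-- In a weakly increasing Fubini ranking, the a_i - 1 entries below a_i all precede
-- car i, so a_i ≤ i; if moreover a_{i-1} < a_i then all i - 1 earlier entries are
-- below a_i, so a_i = i. Hence every car i parks at spot i, car i is lucky exactly
-- when a_i = i, and otherwise a_i = a_{i-1}. Starting from a_1 = 1, the lucky set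
-- thus determines the ranking entry by entry.
module Submission where

open import Defs
open import Data.Nat using (ℕ; _≤_)
open import Data.Vec using (Vec)
open import Data.Fin.Subset using (Subset)
open import Data.Product using (∃; ∃!)
open import Relation.Binary.PropositionalEquality using (_≡_)

open import Data.Nat using (zero; suc; _<_; _+_; z≤n; s≤s; _≟_; _<?_)
open import Data.Nat.Properties
open import Data.Bool using (T)
open import Data.Sum using (_⊎_; inj₁; inj₂)
open import Data.Vec using ([]; _∷_; lookup; tabulate)
open import Data.Vec.Properties using (lookup∘tabulate; tabulate∘lookup; tabulate-cong)
open import Data.Fin using (toℕ; inject₁) renaming (zero to fzero; suc to fsuc)
open import Data.Fin.Properties using (toℕ-inject₁)
open import Data.Fin.Induction using (<-weakInduction)
open import Data.List using (List; length; applyDownFrom)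
open import Data.List.Properties using (filter-accept; filter-reject; length-applyDownFrom)
open import Data.List.Membership.DecPropositional _≟_ using (_∈?_; _∈_)
open import Data.List.Membership.Propositional.Properties using (∈-applyDownFrom⁺; ∈-applyDownFrom⁻)
open import Data.Product using (_,_; _×_; proj₁; proj₂)
open import Function using (_∘_)
open import Function.Bundles using (_⇔_; mk⇔; Equivalence)
open import Relation.Nullary using (¬_; yes; no; contradiction)
open import Relation.Nullary.Decidable using (⌊_⌋; toWitness; fromWitness)
open import Relation.Binary.PropositionalEquality using (refl; sym; trans; cong; subst; module ≡-Reasoning)

-- Spots k, k-1, …, 1: the order in which parkAux accumulates occupied spots when
-- cars park one after another, so that spotsUpTo (suc k) ≡ suc k ∷ spotsUpTo k.
spotsUpTo : ℕ → List ℕ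
spotsUpTo = applyDownFrom suc

∈-spotsUpTo⁻ : ∀ {k s} → s ∈ spotsUpTo k → s ≤ k
∈-spotsUpTo⁻ s∈ with _ , i<k , refl ← ∈-applyDownFrom⁻ suc s∈ = i<k

firstFree-spotsUpTo : ∀ {k} f s → 1 ≤ s → s ≤ suc k → suc k ≤ f + s →
                      firstFree f (spotsUpTo k) s ≡ suc k
firstFree-spotsUpTo zero s _ s≤1+k 1+k≤s = ≤-antisym s≤1+k 1+k≤s
firstFree-spotsUpTo {k} (suc f) s 1≤s s≤1+k enoughFuel with s ∈? spotsUpTo k
... | yes s∈ = firstFree-spotsUpTo f (suc s) (s≤s z≤n) (s≤s (∈-spotsUpTo⁻ s∈))
                 (subst (suc k ≤_) (sym (+-suc f s)) enoughFuel)
... | no s∉ with m≤n⇒m<n∨m≡n s≤1+k | 1≤s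
...   | inj₂ s≡1+k      | _       = s≡1+k
...   | inj₁ (s≤s s'<k) | s≤s z≤n = contradiction (∈-applyDownFrom⁺ suc s'<k) s∉

firstFree-afterSpotsUpTo : ∀ {k s} → 1 ≤ s → s ≤ suc k →
                           firstFree (suc (length (spotsUpTo k))) (spotsUpTo k) s ≡ suc k
firstFree-afterSpotsUpTo {k} {s} 1≤s s≤1+k = firstFree-spotsUpTo _ s 1≤s s≤1+k
  (subst (λ m → suc k ≤ suc m + s) (sym (length-applyDownFrom suc k)) (m≤m+n (suc k) s))

parkAux-spotsUpTo : ∀ {m} k (as : Vec ℕ m) →
                    (∀ p → 1 ≤ lookup as p × lookup as p ≤ suc (k + toℕ p)) →
                    ∀ p → lookup (parkAux (spotsUpTo k) as) p ≡ suc (k + toℕ p)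
parkAux-spotsUpTo k (a ∷ as) bounds p
  rewrite firstFree-afterSpotsUpTo (proj₁ (bounds fzero))
            (subst (λ m → a ≤ suc m) (+-identityʳ k) (proj₂ (bounds fzero)))
  with p
... | fzero  = cong suc (sym (+-identityʳ k))
... | fsuc p = trans (parkAux-spotsUpTo (suc k) as boundsTail p)
                     (cong suc (sym (+-suc k (toℕ p))))
  where
  boundsTail : ∀ p → 1 ≤ lookup as p × lookup as p ≤ suc (suc k + toℕ p)
  boundsTail p = proj₁ (bounds (fsuc p)) ,
                 subst (λ m → lookup as p ≤ suc m) (+-suc k (toℕ p)) (proj₂ (bounds (fsuc p)))

countBelow-∷-< : ∀ {n x v} (xs : Vec ℕ n) → x < v →
                 countBelow (x ∷ xs) v ≡ suc (countBelow xs v)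
countBelow-∷-< {v = v} _ x<v = cong length (filter-accept (_<? v) x<v)

countBelow-∷-≮ : ∀ {n x v} (xs : Vec ℕ n) → ¬ x < v →
                 countBelow (x ∷ xs) v ≡ countBelow xs v
countBelow-∷-≮ {v = v} _ x≮v = cong length (filter-reject (_<? v) x≮v)

WeaklyIncreasing-tail : ∀ {n x} (xs : Vec ℕ n) →
                        WeaklyIncreasing (x ∷ xs) → WeaklyIncreasing xs
WeaklyIncreasing-tail _ incr i j i≤j = incr (fsuc i) (fsuc j) (s≤s i≤j)

countBelow-lowerBound : ∀ {n v} (α : Vec ℕ n) → (∀ k → v ≤ lookup α k) → countBelow α v ≡ 0
countBelow-lowerBound []       _   = refl
countBelow-lowerBound (x ∷ xs) v≤α =
  trans (countBelow-∷-≮ xs (≤⇒≯ (v≤α fzero))) (countBelow-lowerBound xs (v≤α ∘ fsuc))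

countBelow-≤-index : ∀ {n v} (α : Vec ℕ n) → WeaklyIncreasing α →
                     ∀ i → v ≤ lookup α i → countBelow α v ≤ toℕ i
countBelow-≤-index (x ∷ xs) incr fzero v≤x =
  ≤-reflexive (countBelow-lowerBound (x ∷ xs) (λ k → ≤-trans v≤x (incr fzero k z≤n)))
countBelow-≤-index {v = v} (x ∷ xs) incr (fsuc i) v≤αi with x <? v
... | yes x<v = ≤-trans (≤-reflexive (countBelow-∷-< xs x<v))
                        (s≤s (countBelow-≤-index xs (WeaklyIncreasing-tail xs incr) i v≤αi))
... | no x≮v  = ≤-trans (≤-reflexive (countBelow-∷-≮ xs x≮v))
                        (m≤n⇒m≤1+n (countBelow-≤-index xs (WeaklyIncreasing-tail xs incr) i v≤αi))

index<countBelow : ∀ {n v} (α : Vec ℕ n) → WeaklyIncreasing α →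
                   ∀ j → lookup α j < v → toℕ j < countBelow α v
index<countBelow (x ∷ xs) _ fzero x<v =
  ≤-trans (s≤s z≤n) (≤-reflexive (sym (countBelow-∷-< xs x<v)))
index<countBelow (x ∷ xs) incr (fsuc j) αj<v =
  ≤-trans (s≤s (index<countBelow xs (WeaklyIncreasing-tail xs incr) j αj<v))
          (≤-reflexive (sym (countBelow-∷-< xs (≤-<-trans (incr fzero (fsuc j) z≤n) αj<v))))

module _ {n} (α : Vec ℕ n) (fubini : IsFubini α) (incr : WeaklyIncreasing α) where

  rank≤position : ∀ i → lookup α i ≤ suc (toℕ i)
  rank≤position i = ≤-trans (≤-reflexive (proj₂ fubini i))
                            (s≤s (countBelow-≤-index α incr i ≤-refl))

  rank-jump : ∀ j i → lookup α j < lookup α i → suc (toℕ j) < lookup α i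
  rank-jump j i αj<αi = ≤-trans (s≤s (index<countBelow α incr j αj<αi))
                                (≤-reflexive (sym (proj₂ fubini i)))

  parkingOutcome-position : ∀ i → lookup (parkingOutcome α) i ≡ suc (toℕ i)
  parkingOutcome-position =
    parkAux-spotsUpTo 0 α (λ p → proj₁ (proj₁ fubini p) , rank≤position p)

  lucky⇔rank≡position : ∀ i → T (lookup (Lucky α) i) ⇔ (lookup α i ≡ suc (toℕ i))
  lucky⇔rank≡position i
    rewrite lookup∘tabulate (λ i → ⌊ lookup (parkingOutcome α) i ≟ lookup α i ⌋) i
          | parkingOutcome-position i
    = mk⇔ (sym ∘ toWitness) (fromWitness ∘ sym)

first-rank≡1 : ∀ {n} (α : Vec ℕ (suc n)) → IsFubini α → WeaklyIncreasing α →
               lookup α fzero ≡ 1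
first-rank≡1 α fubini incr =
  ≤-antisym (rank≤position α fubini incr fzero) (proj₁ (proj₁ fubini fzero))

rank-repeats-or-jumps : ∀ {n} (α : Vec ℕ (suc n)) → IsFubini α → WeaklyIncreasing α → ∀ i →
                        lookup α (fsuc i) ≡ lookup α (inject₁ i) ⊎
                        lookup α (fsuc i) ≡ suc (toℕ (fsuc i))
rank-repeats-or-jumps α fubini incr i
  with m≤n⇒m<n∨m≡n (incr (inject₁ i) (fsuc i) (m≤n⇒m≤1+n (≤-reflexive (toℕ-inject₁ i))))
... | inj₂ repeats = inj₁ (sym repeats)
... | inj₁ jumps   = inj₂ (≤-antisym (rank≤position α fubini incr (fsuc i))
                      (subst (λ m → suc (suc m) ≤ lookup α (fsuc i)) (toℕ-inject₁ i)
                             (rank-jump α fubini incr (inject₁ i) (fsuc i) jumps)))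

rank≡position-transfer : ∀ {n} (α β : Vec ℕ n) → IsFubini α → WeaklyIncreasing α →
                         IsFubini β → WeaklyIncreasing β → Lucky α ≡ Lucky β →
                         ∀ i → lookup α i ≡ suc (toℕ i) → lookup β i ≡ suc (toℕ i)
rank≡position-transfer α β fα iα fβ iβ sameLuck i αi≡ =
  Equivalence.to (lucky⇔rank≡position β fβ iβ i)
    (subst (λ L → T (lookup L i)) sameLuck
           (Equivalence.from (lucky⇔rank≡position α fα iα i) αi≡))

Lucky-injective : ∀ {n} {α β : Vec ℕ n} → IsFubini α → WeaklyIncreasing α →
                  IsFubini β → WeaklyIncreasing β → Lucky α ≡ Lucky β → α ≡ β
Lucky-injective {α = []} {[]} _ _ _ _ _ = refl
Lucky-injective {suc n} {α} {β} fα iα fβ iβ sameLuck = begin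
  α                   ≡⟨ sym (tabulate∘lookup α) ⟩
  tabulate (lookup α) ≡⟨ tabulate-cong (<-weakInduction (λ i → lookup α i ≡ lookup β i)
                                                         agreeFirst agreeNext) ⟩
  tabulate (lookup β) ≡⟨ tabulate∘lookup β ⟩
  β                   ∎
  where
  open ≡-Reasoning

  α⇒β : ∀ i → lookup α i ≡ suc (toℕ i) → lookup β i ≡ suc (toℕ i)
  α⇒β = rank≡position-transfer α β fα iα fβ iβ sameLuck

  β⇒α : ∀ i → lookup β i ≡ suc (toℕ i) → lookup α i ≡ suc (toℕ i)
  β⇒α = rank≡position-transfer β α fβ iβ fα iα (sym sameLuck)

  agreeFirst : lookup α fzero ≡ lookup β fzero
  agreeFirst = trans (first-rank≡1 α fα iα) (sym (first-rank≡1 β fβ iβ))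

  agreeNext : ∀ i → lookup α (inject₁ i) ≡ lookup β (inject₁ i) →
              lookup α (fsuc i) ≡ lookup β (fsuc i)
  agreeNext i agree with rank-repeats-or-jumps α fα iα i | rank-repeats-or-jumps β fβ iβ i
  ... | inj₂ αjumps     | _             = trans αjumps (sym (α⇒β (fsuc i) αjumps))
  ... | _               | inj₂ βjumps   = trans (β⇒α (fsuc i) βjumps) (sym βjumps)
  ... | inj₁ αrepeats   | inj₁ βrepeats = trans αrepeats (trans agree (sym βrepeats))

theorem2p20 : (n : ℕ) → 1 ≤ n → (I : Subset n) →
    ∃ (λ (β : Vec ℕ n) → WIFRWithLucky I β) →
    ∃! _≡_ (λ (α : Vec ℕ n) → WIFRWithLucky I α)
theorem2p20 _ _ _ (β , wifrβ@(fβ , iβ , luckyβ)) =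
  β , wifrβ , λ (fα , iα , luckyα) → Lucky-injective fβ iβ fα iα (trans luckyβ (sym luckyα))
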